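{- For every positive integer $n$ there exists a finite simple graph $G$ which is 2-connected and prime with respect to the Cartesian product, and such that $m_G(1)\ge n$.
   Context: For a finite simple graph $G$, $L(G)=D(G)-A(G)$ is its Laplacian matrix (degree diagonal matrix minus adjacency matrix), and $m_G(\lambda)$ denotes the multiplicity of $\lambda$ as an eigenvalue of $L(G)$. A graph is $t$-connected if removing fewer than $t$ vertices never leaves a disconnected or trivial graph. A graph is prime with respect to the Cartesian product if it is not isomorphic to a Cartesian product $G_1\,\square\, G_2$ of two graphs each having at least two vertices. -}

module Defs where

open import Data.Nat using (ℕ; zero; suc; _+_; _≤_)
open import Data.Bool using (Bool; true; false; if_then_else_; _∧_; _∨_)
open import Data.Fin using (Fin; zero; suc; _≟_)
open import Data.Fin.Subset using (Subset; _∉_; ∣_∣)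
open import Data.Product using (Σ; _×_; _,_)
open import Data.Rational using (ℚ; 0ℚ; 1ℚ; -_) renaming (_+_ to _+ℚ_; _*_ to _*ℚ_)
open import Data.Integer using (+_)
open import Data.Rational using (_/_)
open import Relation.Binary.PropositionalEquality using (_≡_)
open import Relation.Nullary using (¬_)
open import Relation.Nullary.Decidable using (⌊_⌋)
open import Function.Bundles using (_⤖_; Bijection)

record Graph : Set where
  field
    order   : ℕ
    adj     : Fin order → Fin order → Bool
    adj-sym : ∀ u v → adj u v ≡ adj v u
    adj-irr : ∀ u → adj u u ≡ false
open Graph public

∑ : ∀ {k} → (Fin k → ℚ) → ℚ
∑ {zero}  f = 0ℚ
∑ {suc k} f = f zero +ℚ ∑ (λ i → f (suc i))

count : ∀ {k} → (Fin k → Bool) → ℕ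
count {zero}  p = 0
count {suc k} p = (if p zero then 1 else 0) + count (λ i → p (suc i))

degree : (G : Graph) → Fin (order G) → ℕ
degree G u = count (adj G u)

ℕ→ℚ : ℕ → ℚ
ℕ→ℚ n = (+ n) / 1

Laplacian : (G : Graph) → Fin (order G) → Fin (order G) → ℚ
Laplacian G i j =
  if ⌊ i ≟ j ⌋ then ℕ→ℚ (degree G i)
  else (if adj G i j then - 1ℚ else 0ℚ)

-- x is an eigenvector of L(G) for eigenvalue λ (x ≠ 0 is implied by linear
-- independence below).
IsEigenvector : (G : Graph) → ℚ → (Fin (order G) → ℚ) → Set
IsEigenvector G λ' x = ∀ i → ∑ (λ j → Laplacian G i j *ℚ x j) ≡ λ' *ℚ x i

LinearlyIndependent : ∀ {n k} → (Fin n → Fin k → ℚ) → Set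
LinearlyIndependent {n} {k} v =
  ∀ (c : Fin n → ℚ) → (∀ j → ∑ (λ i → c i *ℚ v i j) ≡ 0ℚ) → ∀ i → c i ≡ 0ℚ

-- m_G(λ) ≥ n : the λ-eigenspace of the symmetric matrix L(G) has dimension ≥ n
-- (for a symmetric matrix geometric = algebraic multiplicity).
MultiplicityAtLeast : (G : Graph) → ℚ → ℕ → Set
MultiplicityAtLeast G λ' n =
  Σ (Fin n → Fin (order G) → ℚ) λ v →
    (∀ i → IsEigenvector G λ' (v i)) × LinearlyIndependent v

data WalkAvoiding (G : Graph) (S : Subset (order G)) : Fin (order G) → Fin (order G) → Set where
  here : ∀ {u} → u ∉ S → WalkAvoiding G S u u
  step : ∀ {u w v} → u ∉ S → adj G u w ≡ true → WalkAvoiding G S w v → WalkAvoiding G S u v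

RemovalNontrivialConnected : (G : Graph) → Subset (order G) → Set
RemovalNontrivialConnected G S =
  (2 + ∣ S ∣ ≤ order G) ×
  (∀ u v → u ∉ S → v ∉ S → WalkAvoiding G S u v)

IsConnected : ℕ → Graph → Set
IsConnected t G = ∀ (S : Subset (order G)) → suc ∣ S ∣ ≤ t → RemovalNontrivialConnected G S

cartAdj : (G₁ G₂ : Graph) → Fin (order G₁) × Fin (order G₂) → Fin (order G₁) × Fin (order G₂) → Bool
cartAdj G₁ G₂ (x₁ , y₁) (x₂ , y₂) =
  (⌊ x₁ ≟ x₂ ⌋ ∧ adj G₂ y₁ y₂) ∨ (adj G₁ x₁ x₂ ∧ ⌊ y₁ ≟ y₂ ⌋)

IsoToProduct : (G G₁ G₂ : Graph) → Set
IsoToProduct G G₁ G₂ =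
  Σ (Fin (order G) ⤖ (Fin (order G₁) × Fin (order G₂))) λ f →
    ∀ u v → adj G u v ≡ cartAdj G₁ G₂ (Bijection.to f u) (Bijection.to f v)

CartesianPrime : Graph → Set
CartesianPrime G = ¬ (Σ Graph λ G₁ → Σ Graph λ G₂ →
  (2 ≤ order G₁) × (2 ≤ order G₂) × IsoToProduct G G₁ G₂)

-- The witness is a generalised theta graph: two hubs joined by k ≥ 2 paths
-- hubₗ – left i – right i – hubᵣ of length 3 and by l paths of length 2.
-- A vector taking the value c i on both inner vertices of the i-th long path and
-- 0 elsewhere is a Laplacian eigenvector for 1 whenever Σ c i = 0: an inner vertex
-- has degree 2 and its neighbours are a hub (value 0) and its partner (same value),
-- while each hub sees Σ c i or 0. The choices c = e_{i+1} − e_0 give k − 1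
-- independent ones. After deleting one vertex some hub still reaches every vertex,
-- so the graph is 2-connected; and l is chosen to make the order 2 + 2k + l prime,
-- which excludes a Cartesian factorisation since |V(G₁ □ G₂)| = |V(G₁)| |V(G₂)|.

module Submission where

open import Defs
open import Algebra.Bundles using (CommutativeMonoid)
import Algebra.Properties.CommutativeMonoid.Sum as MonoidSum
open import Data.Bool using (Bool; true; false; if_then_else_; _∨_)
open import Data.Bool.Properties using (∨-comm; ∨-identityʳ)
open import Data.Fin using (Fin; zero; suc; _≟_)
open import Data.Fin.Properties using (*↔×; cantor-schröder-bernstein)
open import Data.Fin.Subset using (Subset; _∈_; _∉_; ∣_∣)
open import Data.Fin.Subset.Properties using (_∈?_; x∈p⇒∣p-x∣<∣p∣; x∈p∧x≢y⇒x∈p-y)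
open import Data.List using ([]; _∷_)
open import Data.List.Relation.Unary.All using (_∷_)
open import Data.Nat using (ℕ; zero; suc; _+_; _*_; _∸_; _≤_; _<_; z≤n; s≤s; _!)
open import Data.Nat.Base using (nonTrivial⇒≢1; nonTrivial⇒n>1)
open import Data.Nat.Divisibility using (_∣_; m∣m*n; ∣1⇒≡1; ∣m+n∣m⇒∣n; ∣-trans; m≤n⇒m!∣n!)
open import Data.Nat.ListAction using (product)
open import Data.Nat.Primality using (Prime; prime⇒nonTrivial; prime⇒irreducible)
open import Data.Nat.Primality.Factorisation using (factorise)
import Data.Nat.Properties as ℕ
open import Data.Product using (Σ; _×_; _,_; ∃-syntax)
open import Data.Rational using (ℚ; 0ℚ; 1ℚ; -_; _-_) renaming (_+_ to _+ℚ_; _*_ to _*ℚ_)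
import Data.Rational.Properties as ℚ
open import Data.Rational.Solver using (module +-*-Solver)
open import Data.Sum using (inj₁; inj₂)
open import Function using (_∘_)
open import Function.Bundles using (_⤖_; Injection)
open import Function.Properties.Bijection using (⤖⇒↔)
open import Function.Properties.Inverse using (↔-sym; ↔-trans; ↔⇒↣)
open import Relation.Binary.PropositionalEquality
open import Relation.Nullary using (¬_; does; yes; no; contradiction)
open import Relation.Nullary.Decidable using (dec-true)

n≤m⇒n∣m! : ∀ {n m} → 1 ≤ n → n ≤ m → n ∣ m !
n≤m⇒n∣m! {suc n} _ n≤m = ∣-trans (m∣m*n (n !)) (m≤n⇒m!∣n! n≤m)

prime-divisor : ∀ {n} → 2 ≤ n → ∃[ p ] Prime p × p ∣ n
prime-divisor {suc zero} (s≤s ())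
prime-divisor {suc (suc n)} _ with factorise (suc (suc n))
... | record { factors = [] ; isFactorisation = () }
... | record { factors = p ∷ ps ; isFactorisation = eq ; factorsPrime = prime-p ∷ _ } =
  p , prime-p , subst (p ∣_) (sym eq) (m∣m*n (product ps))

prime-above : ∀ m → ∃[ p ] Prime p × m < p
prime-above m with prime-divisor (ℕ.+-monoˡ-≤ 1 (ℕ.1≤n! m))
... | p , prime-p , p∣m!+1 = p , prime-p , ℕ.≰⇒> p≰m
  where
  instance _ = prime⇒nonTrivial prime-p
  p≰m : ¬ p ≤ m
  p≰m p≤m = nonTrivial⇒≢1 (∣1⇒≡1 (∣m+n∣m⇒∣n p∣m!+1 (n≤m⇒n∣m! (ℕ.<⇒≤ (nonTrivial⇒n>1 p)) p≤m)))

Fin-⤖-×⇒≡* : ∀ {n a b} → Fin n ⤖ (Fin a × Fin b) → n ≡ a * b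
Fin-⤖-×⇒≡* f =
  cantor-schröder-bernstein (Injection.injective (↔⇒↣ e)) (Injection.injective (↔⇒↣ (↔-sym e)))
  where e = ↔-trans (⤖⇒↔ f) (↔-sym *↔×)

¬prime-* : ∀ {a b} → 2 ≤ a → 2 ≤ b → ¬ Prime (a * b)
¬prime-* {a@(suc _)} {b} 2≤a 2≤b prime-ab with prime⇒irreducible prime-ab (m∣m*n b)
... | inj₁ a≡1  = ℕ.<⇒≢ 2≤a (sym a≡1)
... | inj₂ a≡ab = ℕ.<⇒≢ (ℕ.m<m*n a b 2≤b) a≡ab

prime-order⇒CartesianPrime : ∀ G → Prime (order G) → CartesianPrime G
prime-order⇒CartesianPrime G prime-G (G₁ , G₂ , 2≤a , 2≤b , f , _) =
  ¬prime-* 2≤a 2≤b (subst Prime (Fin-⤖-×⇒≡* f) prime-G)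

module _ {c ℓ} (M : CommutativeMonoid c ℓ) where
  open CommutativeMonoid M using (Carrier; _≈_; ∙-congˡ; identityˡ; identityʳ)
    renaming (ε to 0#; trans to ≈-trans)
  open MonoidSum M using (sum; sum-replicate-zero)

  sum-pick : ∀ {n} (a : Fin n) (f : Fin n → Carrier) →
    sum (λ j → if does (a ≟ j) then f j else 0#) ≈ f a
  sum-pick {suc n} zero f = ≈-trans (∙-congˡ (sum-replicate-zero n)) (identityʳ (f zero))
  sum-pick (suc a) f = ≈-trans (identityˡ _) (sum-pick a (f ∘ suc))

module ℕ-Sum = MonoidSum ℕ.+-0-commutativeMonoid
module ℚ-Sum = MonoidSum ℚ.+-0-commutativeMonoid

count≡sum : ∀ {n} (p : Fin n → Bool) → count p ≡ ℕ-Sum.sum (λ j → if p j then 1 else 0)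
count≡sum {zero}  p = refl
count≡sum {suc n} p = cong ((if p zero then 1 else 0) +_) (count≡sum (p ∘ suc))

∑≡sum : ∀ {n} (f : Fin n → ℚ) → ∑ f ≡ ℚ-Sum.sum f
∑≡sum {zero}  f = refl
∑≡sum {suc n} f = cong (f zero +ℚ_) (∑≡sum (f ∘ suc))

sum-neg : ∀ {n} (f : Fin n → ℚ) → ℚ-Sum.sum (λ j → - f j) ≡ - ℚ-Sum.sum f
sum-neg {zero}  f = refl
sum-neg {suc n} f =
  trans (cong (- f zero +ℚ_) (sum-neg (f ∘ suc)))
        (sym (ℚ.neg-distrib-+ (f zero) (ℚ-Sum.sum (f ∘ suc))))

does-≟-sym : ∀ {n} (i j : Fin n) → does (i ≟ j) ≡ does (j ≟ i)
does-≟-sym zero    zero    = refl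
does-≟-sym zero    (suc j) = refl
does-≟-sym (suc i) zero    = refl
does-≟-sym (suc i) (suc j) = does-≟-sym i j

Laplacian-action : ∀ G u (x : Fin (order G) → ℚ) →
  ∑ (λ j → Laplacian G u j *ℚ x j) ≡
    ℕ→ℚ (degree G u) *ℚ x u - ∑ (λ j → if adj G u j then x j else 0ℚ)
Laplacian-action G u x = begin
  ∑ (λ j → Laplacian G u j *ℚ x j)                    ≡⟨ ∑≡sum (λ j → Laplacian G u j *ℚ x j) ⟩
  ℚ-Sum.sum (λ j → Laplacian G u j *ℚ x j)            ≡⟨ ℚ-Sum.sum-cong-≗ split ⟩
  ℚ-Sum.sum (λ j → diagonal j +ℚ - neighbour j)        ≡⟨ ℚ-Sum.∑-distrib-+ diagonal (-_ ∘ neighbour) ⟩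
  ℚ-Sum.sum diagonal +ℚ ℚ-Sum.sum (-_ ∘ neighbour)
    ≡⟨ cong₂ _+ℚ_ (sum-pick ℚ.+-0-commutativeMonoid u (λ j → d *ℚ x j)) (sum-neg neighbour) ⟩
  d *ℚ x u - ℚ-Sum.sum neighbour                      ≡⟨ cong (λ s → d *ℚ x u - s) (∑≡sum neighbour) ⟨
  d *ℚ x u - ∑ neighbour                              ∎
  where
  open ≡-Reasoning
  d = ℕ→ℚ (degree G u)
  diagonal neighbour : Fin (order G) → ℚ
  diagonal j = if does (u ≟ j) then d *ℚ x j else 0ℚ
  neighbour j = if adj G u j then x j else 0ℚ
  split : ∀ j → Laplacian G u j *ℚ x j ≡ diagonal j +ℚ - neighbour j
  split j with u ≟ j
  ... | yes refl rewrite adj-irr G u = sym (ℚ.+-identityʳ _)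
  ... | no _ with adj G u j
  ...   | false = ℚ.*-zeroˡ (x j)
  ...   | true  = begin
    - 1ℚ *ℚ x j      ≡⟨ ℚ.neg-distribˡ-* 1ℚ (x j) ⟨
    - (1ℚ *ℚ x j)    ≡⟨ cong -_ (ℚ.*-identityˡ (x j)) ⟩
    - x j            ≡⟨ ℚ.+-identityˡ (- x j) ⟨
    0ℚ +ℚ - x j      ∎

unit-coordinates⇒LinearlyIndependent : ∀ {n m} (v : Fin n → Fin m → ℚ) (pos : Fin n → Fin m) →
  (∀ i j → v i (pos j) ≡ (if does (j ≟ i) then 1ℚ else 0ℚ)) → LinearlyIndependent v
unit-coordinates⇒LinearlyIndependent v pos unit c combination≡0 j = begin
  c j                                                  ≡⟨ sum-pick ℚ.+-0-commutativeMonoid j c ⟨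
  ℚ-Sum.sum (λ i → if does (j ≟ i) then c i else 0ℚ) ≡⟨ ℚ-Sum.sum-cong-≗ coefficient ⟨
  ℚ-Sum.sum (λ i → c i *ℚ v i (pos j))                ≡⟨ ∑≡sum (λ i → c i *ℚ v i (pos j)) ⟨
  ∑ (λ i → c i *ℚ v i (pos j))                        ≡⟨ combination≡0 (pos j) ⟩
  0ℚ                                                   ∎
  where
  open ≡-Reasoning
  coefficient : ∀ i → c i *ℚ v i (pos j) ≡ (if does (j ≟ i) then c i else 0ℚ)
  coefficient i rewrite unit i j with does (j ≟ i)
  ... | true  = ℚ.*-identityʳ (c i)
  ... | false = ℚ.*-zeroʳ (c i)

∣p∣≤1⇒∈-unique : ∀ {n} {p : Subset n} {x y} → ∣ p ∣ ≤ 1 → x ∈ p → y ∈ p → x ≡ y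
∣p∣≤1⇒∈-unique {x = x} {y} ∣p∣≤1 x∈p y∈p with y ≟ x
... | yes y≡x = sym y≡x
... | no  y≢x =
  contradiction ∣p∣≤1 (ℕ.<⇒≱ (ℕ.≤-<-trans (ℕ.≤-<-trans z≤n ∣p-x-y∣<∣p-x∣) (x∈p⇒∣p-x∣<∣p∣ x∈p)))
  where ∣p-x-y∣<∣p-x∣ = x∈p⇒∣p-x∣<∣p∣ (x∈p∧x≢y⇒x∈p-y y∈p y≢x)

module _ {G : Graph} {S : Subset (order G)} where

  walk-start∉ : ∀ {u v} → WalkAvoiding G S u v → u ∉ S
  walk-start∉ (here u∉S)     = u∉S
  walk-start∉ (step u∉S _ _) = u∉S

  walk-trans : ∀ {u v w} → WalkAvoiding G S u v → WalkAvoiding G S v w → WalkAvoiding G S u w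
  walk-trans (here _)        q = q
  walk-trans (step u∉S uw p) q = step u∉S uw (walk-trans p q)

  walk-sym : ∀ {u v} → WalkAvoiding G S u v → WalkAvoiding G S v u
  walk-sym (here u∉S)              = here u∉S
  walk-sym (step {u} {w} u∉S uw p) =
    walk-trans (walk-sym p) (step (walk-start∉ p) (trans (adj-sym G w u) uw) (here u∉S))

  connected-via : ∀ h → (∀ u → u ∉ S → WalkAvoiding G S u h) →
    ∀ u v → u ∉ S → v ∉ S → WalkAvoiding G S u v
  connected-via h to-h u v u∉S v∉S = walk-trans (to-h u u∉S) (walk-sym (to-h v v∉S))

data Role (k : ℕ) : Set where
  hubₗ hubᵣ mid : Role k
  left right    : Fin k → Role k

shift : ∀ {k} → Role k → Role (suc k)
shift hubₗ      = hubₗ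
shift hubᵣ      = hubᵣ
shift mid       = mid
shift (left i)  = left (suc i)
shift (right i) = right (suc i)

-- Each edge once, oriented from hubₗ towards hubᵣ along the paths
-- hubₗ – left i – right i – hubᵣ and hubₗ – mid – hubᵣ.
arc : ∀ {k} → Role k → Role k → Bool
arc hubₗ      mid       = true
arc hubₗ      (left _)  = true
arc (left i)  (right j) = does (i ≟ j)
arc (right _) hubᵣ      = true
arc mid       hubᵣ      = true
arc _         _         = false

adjacent : ∀ {k} → Role k → Role k → Bool
adjacent r s = arc r s ∨ arc s r

adjacent-irrefl : ∀ {k} (r : Role k) → adjacent r r ≡ false
adjacent-irrefl hubₗ      = refl
adjacent-irrefl hubᵣ      = refl
adjacent-irrefl mid       = refl
adjacent-irrefl (left _)  = refl
adjacent-irrefl (right _) = refl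

left-right-adjacent : ∀ {k} (i : Fin k) → adjacent (left i) (right i) ≡ true
left-right-adjacent i = trans (∨-identityʳ (does (i ≟ i))) (dec-true (i ≟ i) refl)

right-left-adjacent : ∀ {k} (i : Fin k) → adjacent (right i) (left i) ≡ true
right-left-adjacent i = dec-true (i ≟ i) refl

-- Vertex 0 is hubₗ, vertex 1 is hubᵣ, vertices 2 + 2i and 3 + 2i are left i and
-- right i, and the last l vertices are the middles of the paths of length 2.
inner : ∀ k {l} → Fin (k * 2 + l) → Role k
inner zero    r             = mid
inner (suc k) zero          = left zero
inner (suc k) (suc zero)    = right zero
inner (suc k) (suc (suc r)) = shift (inner k r)

role : ∀ k l → Fin (2 + (k * 2 + l)) → Role k
role k l zero          = hubₗ
role k l (suc zero)    = hubᵣ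
role k l (suc (suc r)) = inner k r

theta : ℕ → ℕ → Graph
theta k l = record
  { order   = 2 + (k * 2 + l)
  ; adj     = λ u v → adjacent (role k l u) (role k l v)
  ; adj-sym = λ u v → ∨-comm (arc (role k l u) (role k l v)) (arc (role k l v) (role k l u))
  ; adj-irr = λ u → adjacent-irrefl (role k l u)
  }

leftAt rightAt : ∀ k {l} → Fin k → Fin (k * 2 + l)
leftAt  (suc k) zero    = zero
leftAt  (suc k) (suc i) = suc (suc (leftAt k i))
rightAt (suc k) zero    = suc zero
rightAt (suc k) (suc i) = suc (suc (rightAt k i))

leftVertex rightVertex : ∀ k l → Fin k → Fin (order (theta k l))
leftVertex  k l i = suc (suc (leftAt k i))
rightVertex k l i = suc (suc (rightAt k i))

role-leftVertex : ∀ k l i → role k l (leftVertex k l i) ≡ left i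
role-leftVertex (suc k) l zero    = refl
role-leftVertex (suc k) l (suc i) = cong shift (role-leftVertex k l i)

role-rightVertex : ∀ k l i → role k l (rightVertex k l i) ≡ right i
role-rightVertex (suc k) l zero    = refl
role-rightVertex (suc k) l (suc i) = cong shift (role-rightVertex k l i)

isHub : ∀ {k} → Role k → Bool
isHub hubₗ = true
isHub hubᵣ = true
isHub _    = false

isHub-shift : ∀ {k} (r : Role k) → isHub (shift r) ≡ isHub r
isHub-shift hubₗ      = refl
isHub-shift hubᵣ      = refl
isHub-shift mid       = refl
isHub-shift (left _)  = refl
isHub-shift (right _) = refl

isHub-inner : ∀ k {l} (r : Fin (k * 2 + l)) → isHub (inner k r) ≡ false
isHub-inner zero    r             = refl
isHub-inner (suc k) zero          = refl
isHub-inner (suc k) (suc zero)    = refl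
isHub-inner (suc k) (suc (suc r)) = trans (isHub-shift (inner k r)) (isHub-inner k r)

role-hubₗ : ∀ k l u → role k l u ≡ hubₗ → u ≡ zero
role-hubₗ k l zero          _  = refl
role-hubₗ k l (suc zero)    ()
role-hubₗ k l (suc (suc r)) eq = contradiction (trans (cong isHub (sym eq)) (isHub-inner k r)) λ ()

role-hubᵣ : ∀ k l u → role k l u ≡ hubᵣ → u ≡ suc zero
role-hubᵣ k l zero          ()
role-hubᵣ k l (suc zero)    _  = refl
role-hubᵣ k l (suc (suc r)) eq = contradiction (trans (cong isHub (sym eq)) (isHub-inner k r)) λ ()

module RoleSum {c ℓ} (M : CommutativeMonoid c ℓ) where
  open CommutativeMonoid M using (Carrier; _≈_; ∙-congˡ; assoc)
    renaming (_∙_ to _⊕_; ε to 0#; trans to ≈-trans; sym to ≈-sym)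
  open MonoidSum M using (sum; sum-cong-≋; sum-replicate-zero)

  sum-inner : ∀ k {l} (f : Role k → Carrier) → f mid ≈ 0# →
    sum (f ∘ inner k {l}) ≈ sum (λ i → f (left i) ⊕ f (right i))
  sum-inner zero    {l} f f-mid = ≈-trans (sum-cong-≋ {l} (λ _ → f-mid)) (sum-replicate-zero l)
  sum-inner (suc k) f f-mid =
    ≈-trans (∙-congˡ (∙-congˡ (sum-inner k (f ∘ shift) f-mid))) (≈-sym (assoc _ _ _))

  sum-role : ∀ k l (f : Role k → Carrier) → f mid ≈ 0# →
    sum (f ∘ role k l) ≈ f hubₗ ⊕ (f hubᵣ ⊕ sum (λ i → f (left i) ⊕ f (right i)))
  sum-role k l f f-mid = ∙-congˡ (∙-congˡ (sum-inner k f f-mid))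

module ℕ-RoleSum = RoleSum ℕ.+-0-commutativeMonoid
module ℚ-RoleSum = RoleSum ℚ.+-0-commutativeMonoid

module _ (k l : ℕ) where

  degree-theta : ∀ u → degree (theta k l) u ≡
    ℕ-Sum.sum (λ j → if adjacent (role k l u) (role k l j) then 1 else 0)
  degree-theta u = count≡sum (adj (theta k l) u)

  degree-left : ∀ u {i} → role k l u ≡ left i → degree (theta k l) u ≡ 2
  degree-left u {i} eq = begin
    degree (theta k l) u
      ≡⟨ degree-theta u ⟩
    ℕ-Sum.sum (λ j → if adjacent (role k l u) (role k l j) then 1 else 0)
      ≡⟨ cong (λ ρ → ℕ-Sum.sum (λ j → if adjacent ρ (role k l j) then 1 else 0)) eq ⟩
    ℕ-Sum.sum (λ j → if adjacent (left i) (role k l j) then 1 else 0)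
      ≡⟨ ℕ-RoleSum.sum-role k l (λ s → if adjacent (left i) s then 1 else 0) refl ⟩
    1 + ℕ-Sum.sum (λ a → if does (i ≟ a) ∨ false then 1 else 0)
      ≡⟨ cong (1 +_) (ℕ-Sum.sum-cong-≗ (λ a →
           cong (λ b → if b then 1 else 0) (∨-identityʳ (does (i ≟ a))))) ⟩
    1 + ℕ-Sum.sum (λ a → if does (i ≟ a) then 1 else 0)
      ≡⟨ cong (1 +_) (sum-pick ℕ.+-0-commutativeMonoid i (λ _ → 1)) ⟩
    2 ∎
    where open ≡-Reasoning

  degree-right : ∀ u {i} → role k l u ≡ right i → degree (theta k l) u ≡ 2
  degree-right u {i} eq = begin
    degree (theta k l) u
      ≡⟨ degree-theta u ⟩
    ℕ-Sum.sum (λ j → if adjacent (role k l u) (role k l j) then 1 else 0)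
      ≡⟨ cong (λ ρ → ℕ-Sum.sum (λ j → if adjacent ρ (role k l j) then 1 else 0)) eq ⟩
    ℕ-Sum.sum (λ j → if adjacent (right i) (role k l j) then 1 else 0)
      ≡⟨ ℕ-RoleSum.sum-role k l (λ s → if adjacent (right i) s then 1 else 0) refl ⟩
    1 + ℕ-Sum.sum (λ a → (if does (a ≟ i) then 1 else 0) + 0)
      ≡⟨ cong (1 +_) (ℕ-Sum.sum-cong-≗ (λ a →
           trans (ℕ.+-identityʳ _) (cong (λ b → if b then 1 else 0) (does-≟-sym a i)))) ⟩
    1 + ℕ-Sum.sum (λ a → if does (i ≟ a) then 1 else 0)
      ≡⟨ cong (1 +_) (sum-pick ℕ.+-0-commutativeMonoid i (λ _ → 1)) ⟩
    2 ∎
    where open ≡-Reasoning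

onPaths : ∀ {k} → (Fin k → ℚ) → Role k → ℚ
onPaths c (left i)  = c i
onPaths c (right i) = c i
onPaths c _         = 0ℚ

module _ (k l : ℕ) (c : Fin k → ℚ) (∑c≡0 : ∑ c ≡ 0ℚ) where

  neighbour : Role k → Role k → ℚ
  neighbour ρ s = if adjacent ρ s then onPaths c s else 0ℚ

  neighbour-mid : ∀ ρ → neighbour ρ mid ≡ 0ℚ
  neighbour-mid ρ with adjacent ρ mid
  ... | true  = refl
  ... | false = refl

  neighbours : Role k → ℚ
  neighbours ρ = neighbour ρ hubₗ +ℚ (neighbour ρ hubᵣ +ℚ
                   ℚ-Sum.sum (λ i → neighbour ρ (left i) +ℚ neighbour ρ (right i)))

  private
    ≗c⇒sum≡0 : ∀ {f : Fin k → ℚ} → (∀ i → f i ≡ c i) → ℚ-Sum.sum f ≡ 0ℚ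
    ≗c⇒sum≡0 f≗c = trans (ℚ-Sum.sum-cong-≗ f≗c) (trans (sym (∑≡sum c)) ∑c≡0)

    off-paths : ∀ d {f : Fin k → ℚ} → ℚ-Sum.sum f ≡ 0ℚ →
      d *ℚ 0ℚ - (0ℚ +ℚ (0ℚ +ℚ ℚ-Sum.sum f)) ≡ 1ℚ *ℚ 0ℚ
    off-paths d ∑f≡0 = cong₂ (λ p s → p - (0ℚ +ℚ (0ℚ +ℚ s))) (ℚ.*-zeroʳ d) ∑f≡0

    on-path : ∀ a {f : Fin k → ℚ} → (∀ i → f i ≡ (if does (a ≟ i) then c i else 0ℚ)) →
      ℕ→ℚ 2 *ℚ c a - (0ℚ +ℚ (0ℚ +ℚ ℚ-Sum.sum f)) ≡ 1ℚ *ℚ c a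
    on-path a f≗ =
      trans (cong (λ s → ℕ→ℚ 2 *ℚ c a - (0ℚ +ℚ (0ℚ +ℚ s))) ∑f≡ca) (twice-minus-once (c a))
      where
      open +-*-Solver
      ∑f≡ca = trans (ℚ-Sum.sum-cong-≗ f≗) (sum-pick ℚ.+-0-commutativeMonoid a c)
      twice-minus-once : ∀ v → ℕ→ℚ 2 *ℚ v - (0ℚ +ℚ (0ℚ +ℚ v)) ≡ 1ℚ *ℚ v
      twice-minus-once =
        solve 1 (λ v → con (ℕ→ℚ 2) :* v :- (con 0ℚ :+ (con 0ℚ :+ v)) := con 1ℚ :* v) refl

  eigen-equation : ∀ u ρ → role k l u ≡ ρ →
    ℕ→ℚ (degree (theta k l) u) *ℚ onPaths c ρ - neighbours ρ ≡ 1ℚ *ℚ onPaths c ρ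
  eigen-equation u hubₗ _ = off-paths (ℕ→ℚ (degree (theta k l) u)) (≗c⇒sum≡0 (λ i → ℚ.+-identityʳ (c i)))
  eigen-equation u hubᵣ _ = off-paths (ℕ→ℚ (degree (theta k l) u)) (≗c⇒sum≡0 (λ i → ℚ.+-identityˡ (c i)))
  eigen-equation u mid  _ = off-paths (ℕ→ℚ (degree (theta k l) u)) (ℚ-Sum.sum-replicate-zero k)
  eigen-equation u (left a) eq rewrite degree-left k l u eq = on-path a λ i →
    trans (ℚ.+-identityˡ _) (cong (λ b → if b then c i else 0ℚ) (∨-identityʳ (does (a ≟ i))))
  eigen-equation u (right a) eq rewrite degree-right k l u eq = on-path a λ i →
    trans (ℚ.+-identityʳ _) (cong (λ b → if b then c i else 0ℚ) (does-≟-sym i a))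

  theta-eigenvector : IsEigenvector (theta k l) 1ℚ (onPaths c ∘ role k l)
  theta-eigenvector u = begin
    ∑ (λ j → Laplacian G u j *ℚ x j)                          ≡⟨ Laplacian-action G u x ⟩
    d *ℚ x u - ∑ (λ j → neighbour (role k l u) (role k l j))  ≡⟨ cong (λ s → d *ℚ x u - s) neighbour-sum ⟩
    d *ℚ x u - neighbours (role k l u)                         ≡⟨ eigen-equation u (role k l u) refl ⟩
    1ℚ *ℚ x u                                                  ∎
    where
    open ≡-Reasoning
    G = theta k l
    x = onPaths c ∘ role k l
    d = ℕ→ℚ (degree G u)
    neighbour-sum : ∑ (λ j → neighbour (role k l u) (role k l j)) ≡ neighbours (role k l u)
    neighbour-sum = trans (∑≡sum (neighbour (role k l u) ∘ role k l))
                          (ℚ-RoleSum.sum-role k l (neighbour (role k l u)) (neighbour-mid (role k l u)))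

unit-difference : ∀ {n} → Fin n → Fin (suc n) → ℚ
unit-difference i zero    = - 1ℚ
unit-difference i (suc j) = if does (j ≟ i) then 1ℚ else 0ℚ

∑-unit-difference : ∀ {n} (i : Fin n) → ∑ (unit-difference i) ≡ 0ℚ
∑-unit-difference i = cong (- 1ℚ +ℚ_) (begin
  ∑ (unit-difference i ∘ suc)                          ≡⟨ ∑≡sum (unit-difference i ∘ suc) ⟩
  ℚ-Sum.sum (λ j → if does (j ≟ i) then 1ℚ else 0ℚ)
    ≡⟨ ℚ-Sum.sum-cong-≗ (λ j → cong (λ b → if b then 1ℚ else 0ℚ) (does-≟-sym j i)) ⟩
  ℚ-Sum.sum (λ j → if does (i ≟ j) then 1ℚ else 0ℚ)  ≡⟨ sum-pick ℚ.+-0-commutativeMonoid i (λ _ → 1ℚ) ⟩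
  1ℚ                                                   ∎)
  where open ≡-Reasoning

theta-multiplicity : ∀ n l → MultiplicityAtLeast (theta (suc n) l) 1ℚ n
theta-multiplicity n l =
  vectors ,
  (λ i → theta-eigenvector (suc n) l (unit-difference i) (∑-unit-difference i)) ,
  unit-coordinates⇒LinearlyIndependent vectors (leftVertex (suc n) l ∘ suc)
    (λ i j → cong (onPaths (unit-difference i)) (role-leftVertex (suc n) l (suc j)))
  where
  vectors : Fin n → Fin (order (theta (suc n) l)) → ℚ
  vectors i = onPaths (unit-difference i) ∘ role (suc n) l

left-injective : ∀ {k} {i j : Fin k} → left i ≡ left j → i ≡ j
left-injective refl = refl

other : ∀ {k} → Fin (2 + k) → Fin (2 + k)
other zero    = suc zero
other (suc _) = zero

other-≢ : ∀ {k} (a : Fin (2 + k)) → other a ≢ a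
other-≢ zero    ()
other-≢ (suc _) ()

module Theta-2-Connected (k l : ℕ) (S : Subset (order (theta (2 + k) l))) (∣S∣≤1 : ∣ S ∣ ≤ 1) where
  private
    K = 2 + k
    G = theta K l
    Walk = WalkAvoiding G S
    ρ = role K l
    ℓ = leftVertex K l
    r = rightVertex K l
    ρℓ = role-leftVertex K l
    ρr = role-rightVertex K l

  hₗ hᵣ : Fin (order G)
  hₗ = zero
  hᵣ = suc zero

  hop : ∀ {u w α β} v → u ∉ S → ρ u ≡ α → ρ v ≡ β → adjacent α β ≡ true → Walk v w → Walk u w
  hop v u∉S refl refl αβ = step u∉S αβ

  ∉-beside : ∀ {x y α β} → y ∈ S → ρ x ≡ α → ρ y ≡ β → α ≢ β → x ∉ S
  ∉-beside y∈S refl refl α≢β x∈S = α≢β (cong ρ (∣p∣≤1⇒∈-unique ∣S∣≤1 x∈S y∈S))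

  module _ (hₗ∉S : hₗ ∉ S) where

    -- If left a is the deleted vertex, detour through hᵣ and another path b.
    right→hₗ : ∀ a {u} → ρ u ≡ right a → u ∉ S → Walk u hₗ
    right→hₗ a u-right u∉S with ℓ a ∈? S
    ... | no  ℓa∉S =
      hop (ℓ a) u∉S u-right (ρℓ a) (right-left-adjacent a) (hop hₗ ℓa∉S (ρℓ a) refl refl (here hₗ∉S))
    ... | yes ℓa∈S =
      hop hᵣ u∉S u-right refl refl
        (hop (r b) (∉-beside ℓa∈S refl (ρℓ a) λ ()) refl (ρr b) refl
          (hop (ℓ b) (∉-beside ℓa∈S (ρr b) (ρℓ a) λ ()) (ρr b) (ρℓ b) (right-left-adjacent b)
            (hop hₗ (∉-beside ℓa∈S (ρℓ b) (ρℓ a) (other-≢ a ∘ left-injective)) (ρℓ b) refl refl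
              (here hₗ∉S))))
      where b = other a

    to-hₗ : ∀ u α → ρ u ≡ α → u ∉ S → Walk u hₗ
    to-hₗ u hubₗ      eq u∉S = subst (λ v → Walk v hₗ) (sym (role-hubₗ K l u eq)) (here hₗ∉S)
    to-hₗ u mid       eq u∉S = hop hₗ u∉S eq refl refl (here hₗ∉S)
    to-hₗ u (left _)  eq u∉S = hop hₗ u∉S eq refl refl (here hₗ∉S)
    to-hₗ u (right a) eq u∉S = right→hₗ a eq u∉S
    to-hₗ u hubᵣ      eq u∉S with r zero ∈? S
    ... | no  r0∉S = hop (r zero) u∉S eq (ρr zero) refl (right→hₗ zero (ρr zero) r0∉S)
    ... | yes r0∈S =
      hop (r one) u∉S eq (ρr one) refl (right→hₗ one (ρr one) (∉-beside r0∈S (ρr one) (ρr zero) λ ()))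
      where one = suc zero

  module _ (hₗ∈S : hₗ ∈ S) where

    hᵣ∉S : hᵣ ∉ S
    hᵣ∉S = ∉-beside hₗ∈S refl refl λ ()

    to-hᵣ : ∀ u α → ρ u ≡ α → u ∉ S → Walk u hᵣ
    to-hᵣ u hubₗ      eq u∉S = contradiction (subst (_∈ S) (sym (role-hubₗ K l u eq)) hₗ∈S) u∉S
    to-hᵣ u hubᵣ      eq u∉S = subst (λ v → Walk v hᵣ) (sym (role-hubᵣ K l u eq)) (here hᵣ∉S)
    to-hᵣ u mid       eq u∉S = hop hᵣ u∉S eq refl refl (here hᵣ∉S)
    to-hᵣ u (right _) eq u∉S = hop hᵣ u∉S eq refl refl (here hᵣ∉S)
    to-hᵣ u (left a)  eq u∉S =
      hop (r a) u∉S eq (ρr a) (left-right-adjacent a)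
        (hop hᵣ (∉-beside hₗ∈S (ρr a) refl λ ()) (ρr a) refl refl (here hᵣ∉S))

  connected : ∀ u v → u ∉ S → v ∉ S → Walk u v
  connected with hₗ ∈? S
  ... | no  hₗ∉S = connected-via hₗ (λ u → to-hₗ hₗ∉S u (ρ u) refl)
  ... | yes hₗ∈S = connected-via hᵣ (λ u → to-hᵣ hₗ∈S u (ρ u) refl)

theta-2-connected : ∀ k l → IsConnected 2 (theta (2 + k) l)
theta-2-connected k l S (s≤s ∣S∣≤1) =
  s≤s (s≤s (ℕ.≤-trans ∣S∣≤1 (s≤s z≤n))) , Theta-2-Connected.connected k l S ∣S∣≤1

theorem1p1 : (n : ℕ) → 1 ≤ n →
    Σ Graph (λ G → IsConnected 2 G × CartesianPrime G × MultiplicityAtLeast G 1ℚ n)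
theorem1p1 n@(suc m) _ with prime-above (2 + suc n * 2)
... | p , prime-p , bound =
  theta (suc n) l ,
  theta-2-connected m l ,
  prime-order⇒CartesianPrime (theta (suc n) l) (subst Prime (sym order≡p) prime-p) ,
  theta-multiplicity n l
  where
  l = p ∸ (2 + suc n * 2)
  order≡p : order (theta (suc n) l) ≡ p
  order≡p = ℕ.m+[n∸m]≡n (ℕ.<⇒≤ bound)
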